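{- Let $p$ be an odd prime and $t \geq 1$ an integer dividing $p-1$. Let $\theta$ be a generator of $\mathbb{F}_p^*$, $\mu = \theta^{(p-1)/t}$, $\Gamma = \mathbb{Z}_{(p-1)/t} \times \mathbb{F}_p$, and \[ S = \{ (m, \theta^m \mu^n) : m \in \mathbb{Z}_{(p-1)/t},\ 0 \leq n \leq t-1 \}, \] where $m$ is identified with its least nonnegative residue when computing $\theta^m$. Let $H_{p,t}$ be the graph on $\Gamma$ in which distinct $(x,y),(a,b)$ are adjacent iff $(x,y)+(a,b)\in S$, and let $H_{p,t}^*$ be obtained from $H_{p,t}$ by adding a new vertex adjacent to exactly the vertices of degree $p-2$ in $H_{p,t}$. Then $H_{p,t}^*$ is a $(p-1)$-regular graph with $\frac{p(p-1)}{t} + 1$ vertices and contains no subgraph isomorphic to $K_{2,2t+1}$.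
   Context: $K_{2,2t+1}$ is the complete bipartite graph with parts of sizes $2$ and $2t+1$. -}

module Defs where

open import Data.Nat using (ℕ; zero; suc; _+_; _*_; _∸_; _^_; _%_; _≡ᵇ_; _≤_; _<_)
open import Data.Bool using (Bool; true; false; _∧_; not; T)
open import Data.Fin using (Fin; toℕ)
open import Data.Maybe using (Maybe; just; nothing)
open import Data.Product using (_×_; _,_; Σ)
open import Data.List using (List; []; _∷_; length; filterᵇ; upTo; allFin; cartesianProduct; map)
open import Relation.Binary.PropositionalEquality using (_≡_; _≢_)
open import Relation.Nullary using (¬_)
open import Function.Definitions using (Injective)
open import Data.Bool.ListAction using (any)

-- total reduction mod n (with the harmless convention a mod' 0 = a);
-- only ever used with n ≥ 1 in the theorem.
_mod'_ : ℕ → ℕ → ℕ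
a mod' zero    = a
a mod' (suc k) = a % suc k

IsGenerator : ℕ → ℕ → Set
IsGenerator p θ =
  θ < p × (θ ^ (p ∸ 1)) mod' p ≡ 1 ×
  (∀ k → 1 ≤ k → k < p ∸ 1 → (θ ^ k) mod' p ≢ 1)

-- Parameters: p, q = (p-1)/t, t, θ.  μ = θ ^ q = θ^((p-1)/t).
-- Membership of (m, y) ∈ ℤ_q × 𝔽ₚ (given by least nonnegative residues m < q, y < p)
-- in S = {(m, θ^m μ^n) : m ∈ ℤ_q, 0 ≤ n ≤ t-1}.
inS : (p q t θ : ℕ) → ℕ → ℕ → Bool
inS p q t θ m y = any (λ n → ((θ ^ m) * ((θ ^ q) ^ n)) mod' p ≡ᵇ y) (upTo t)

Γ : ℕ → ℕ → Set
Γ p q = Fin q × Fin p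

Γ-list : (p q : ℕ) → List (Γ p q)
Γ-list p q = cartesianProduct (allFin q) (allFin p)

eqΓ : {p q : ℕ} → Γ p q → Γ p q → Bool
eqΓ (x , y) (a , b) = (toℕ x ≡ᵇ toℕ a) ∧ (toℕ y ≡ᵇ toℕ b)

adjH : (p q t θ : ℕ) → Γ p q → Γ p q → Bool
adjH p q t θ (x , y) (a , b) =
  not (eqΓ (x , y) (a , b)) ∧
  inS p q t θ ((toℕ x + toℕ a) mod' q) ((toℕ y + toℕ b) mod' p)

degH : (p q t θ : ℕ) → Γ p q → ℕ
degH p q t θ v = length (filterᵇ (adjH p q t θ v) (Γ-list p q))

-- H*_{p,t}: vertex set Γ plus a new vertex (nothing)
V* : ℕ → ℕ → Set
V* p q = Maybe (Γ p q)

V*-list : (p q : ℕ) → List (V* p q)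
V*-list p q = nothing ∷ map just (Γ-list p q)

adj* : (p q t θ : ℕ) → V* p q → V* p q → Bool
adj* p q t θ nothing  nothing  = false
adj* p q t θ nothing  (just w) = degH p q t θ w ≡ᵇ (p ∸ 2)
adj* p q t θ (just v) nothing  = degH p q t θ v ≡ᵇ (p ∸ 2)
adj* p q t θ (just v) (just w) = adjH p q t θ v w

deg* : (p q t θ : ℕ) → V* p q → ℕ
deg* p q t θ v = length (filterᵇ (adj* p q t θ v) (V*-list p q))

ContainsK2 : (V : Set) → (V → V → Bool) → ℕ → Set
ContainsK2 V adj s =
  Σ V λ u₁ → Σ V λ u₂ → u₁ ≢ u₂ ×
  Σ (Fin s → V) λ f → Injective _≡_ _≡_ f ×
  (∀ i → f i ≢ u₁ × f i ≢ u₂ × T (adj u₁ (f i)) × T (adj u₂ (f i)))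

-- The connection set S is the image of e ↦ (e mod q, θᵉ) on the exponents 0 ≤ e < p - 1, so (m, y) ∈ S
-- exactly when y has a discrete logarithm ≡ m (mod q), and each m has t partners y.
--
-- Degrees: translation is a bijection of 𝔽ₚ, so every v ∈ Γ has exactly p - 1 vertices w with v + w ∈ S;
-- w = v is among them precisely when 2v ∈ S, and those v are the vertices of degree p - 2. As doubling is a
-- bijection of 𝔽ₚ for odd p, there are p - 1 of them, which is the degree of the new vertex.
--
-- No K₂,₂ₜ₊₁: a common neighbour w of v = (x, y) ≠ v′ = (x′, y′) in Γ is determined by
-- log(v′ + w) - log(v + w), which is ≡ x′ - x (mod q) and so takes at most t values; with the new vertex
-- that is t + 1 common neighbours. A common neighbour w = (a, b) of the new vertex and v satisfies
-- (y + b)² = 2b θᵉ with e = 2 log(v + w) - log(2w) ≡ 2x (mod q); e takes at most t values, and for each e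
-- the element b is one of the two roots of a quadratic, so there are at most 2t such w.

module Submission where

open import Defs
open import Data.Bool using (Bool; true; false; _∧_; _∨_; not; T; T?; if_then_else_)
import Data.Bool.Properties as Bool
open import Data.Bool.ListAction using (any; or)
open import Data.Empty using (⊥; ⊥-elim)
open import Data.Fin using (Fin; toℕ; zero; suc; fromℕ<; combine; remQuot)
open import Data.Fin.Properties using (toℕ-injective; toℕ-fromℕ<; toℕ<n; suc-injective; <⇒notInjective; combine-injective; combine-remQuot; remQuot-combine; 2↔Bool)
open import Data.Integer as ℤ using (ℤ; +_; 0ℤ; ∣_∣; _%ℕ_; _/ℕ_)
import Data.Integer.Properties as ℤ
import Data.Integer.DivMod as ℤ
open import Data.Integer.Divisibility.Signed using (_∣_; divides; ∣m∣n⇒∣m+n; ∣m⇒∣-m; ∣n⇒∣m*n; ∣m⇒∣m*n; ∣⇒∣ᵤ; ∣ᵤ⇒∣)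
open import Data.Integer.Tactic.RingSolver using (solve-∀)
open import Data.List using (List; []; _∷_; length; filterᵇ; allFin; upTo; cartesianProduct; map; _++_)
import Data.List.Properties as List
open import Data.List.Membership.Propositional using (_∈_; find)
open import Data.List.Membership.Propositional.Properties using (∈-allFin; ∈-upTo⁻; ∈-cartesianProduct⁺)
open import Data.List.Relation.Unary.All using (All; []; _∷_)
import Data.List.Relation.Unary.All as All
import Data.List.Relation.Unary.All.Properties as All
open import Data.List.Relation.Unary.AllPairs using (AllPairs; []; _∷_)
import Data.List.Relation.Unary.AllPairs.Properties as AllPairs
open import Data.List.Relation.Unary.Any using (here; there)
open import Data.List.Relation.Unary.Any.Properties using (any⁻)
open import Data.List.Relation.Unary.Unique.Propositional using (Unique)
open import Data.List.Relation.Unary.Unique.Propositional.Properties using (allFin⁺; cartesianProduct⁺)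
open import Data.Maybe using (Maybe; just; nothing)
open import Data.Nat using (ℕ; zero; suc; pred; _+_; _*_; _∸_; _^_; _%_; _/_; _≡ᵇ_; _<ᵇ_; _<_; _≤_; s≤s; z<s; NonZero; >-nonZero; nonTrivial⇒n>1)
import Data.Nat.Properties as ℕ
import Data.Nat.DivMod as ℕ
import Data.Nat.Divisibility as ℕ
open import Data.Nat.Primality using (Prime; Composite; euclidsLemma; prime⇒nonZero; prime⇒nonTrivial; composite-≢; prime⇒¬composite)
open import Data.Product using (_×_; _,_; proj₁; proj₂; Σ)
open import Data.Sum using (_⊎_; inj₁; inj₂; [_,_]′) renaming (map to map-⊎)
open import Function using (id; _∘_)
open import Function.Bundles using (_⇔_; mk⇔; _↔_; _↣_; mk↔ₛ′; Equivalence; Injection)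
open import Function.Properties.Inverse using (↔-sym; ↔⇒↣)
import Function.Properties.Equivalence as ⇔
open import Level using (0ℓ)
open import Relation.Binary.Bundles using (Setoid)
open import Relation.Binary.Definitions using (tri<; tri≈; tri>)
open import Relation.Binary.Structures using (IsEquivalence)
open import Relation.Binary.PropositionalEquality
import Relation.Binary.Reasoning.Setoid
open import Relation.Nullary using (¬_)

≡ᵇ≡true⇔≡ : ∀ m n → (m ≡ᵇ n) ≡ true ⇔ m ≡ n
≡ᵇ≡true⇔≡ m n =
  mk⇔ (ℕ.≡ᵇ⇒≡ m n ∘ Equivalence.from Bool.T-≡) (Equivalence.to Bool.T-≡ ∘ ℕ.≡⇒≡ᵇ m n)

≡ᵇ-cong-⇔ : ∀ {a b c d} → (a ≡ b ⇔ c ≡ d) → (a ≡ᵇ b) ≡ (c ≡ᵇ d)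
≡ᵇ-cong-⇔ {a} {b} {c} {d} a≡b⇔c≡d =
  Bool.⇔→≡ (⇔.trans (≡ᵇ≡true⇔≡ a b) (⇔.trans a≡b⇔c≡d (⇔.sym (≡ᵇ≡true⇔≡ c d))))

<ᵇ-flip⇒≡ : ∀ m n → (m <ᵇ n) ≡ (n <ᵇ m) → m ≡ n
<ᵇ-flip⇒≡ m n m<ᵇn≡n<ᵇm with ℕ.<-cmp m n
... | tri≈ _ m≡n _ = m≡n
... | tri< m<n _ _ = ⊥-elim (ℕ.<-asym m<n (ℕ.<ᵇ⇒< n m (subst T m<ᵇn≡n<ᵇm (ℕ.<⇒<ᵇ m<n))))
... | tri> _ _ n<m = ⊥-elim (ℕ.<-asym n<m (ℕ.<ᵇ⇒< m n (subst T (sym m<ᵇn≡n<ᵇm) (ℕ.<⇒<ᵇ n<m))))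

%-/-injective : ∀ {m o} n .{{_ : NonZero n}} → m % n ≡ o % n → m / n ≡ o / n → m ≡ o
%-/-injective {m} {o} n m%n≡o%n m/n≡o/n = begin
  m                  ≡⟨ ℕ.m≡m%n+[m/n]*n m n ⟩
  m % n + m / n * n  ≡⟨ cong₂ (λ r d → r + d * n) m%n≡o%n m/n≡o/n ⟩
  o % n + o / n * n  ≡⟨ ℕ.m≡m%n+[m/n]*n o n ⟨
  o                  ∎
  where open ≡-Reasoning

^-%-/ : ∀ x n i .{{_ : NonZero n}} → x ^ i ≡ x ^ (i % n) * (x ^ n) ^ (i / n)
^-%-/ x n i = begin
  x ^ i                             ≡⟨ cong (x ^_) (ℕ.m≡m%n+[m/n]*n i n) ⟩
  x ^ (i % n + i / n * n)           ≡⟨ ℕ.^-distribˡ-+-* x (i % n) _ ⟩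
  x ^ (i % n) * x ^ (i / n * n)     ≡⟨ cong (λ e → x ^ (i % n) * x ^ e) (ℕ.*-comm (i / n) n) ⟩
  x ^ (i % n) * x ^ (n * (i / n))   ≡⟨ cong (x ^ (i % n) *_) (ℕ.^-*-assoc x n (i / n)) ⟨
  x ^ (i % n) * (x ^ n) ^ (i / n)   ∎
  where open ≡-Reasoning

m<q⇒n<t⇒m+q*n<q*t : ∀ {m n q t} → m < q → n < t → m + q * n < q * t
m<q⇒n<t⇒m+q*n<q*t {m} {n} {q} {t} m<q n<t = begin-strict
  m + q * n    <⟨ ℕ.+-monoˡ-< (q * n) m<q ⟩
  q + q * n    ≡⟨ ℕ.*-suc q n ⟨
  q * suc n    ≤⟨ ℕ.*-monoʳ-≤ q n<t ⟩
  q * t        ∎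
  where open ℕ.≤-Reasoning

1+t<2t+1 : ∀ {t} → 1 ≤ t → suc t < 2 * t + 1
1+t<2t+1 {t} 1≤t = begin-strict
  suc t        <⟨ s≤s (ℕ.m<m+n t 1≤t) ⟩
  suc (t + t)  ≡⟨ cong (λ n → suc (t + n)) (ℕ.+-identityʳ t) ⟨
  1 + 2 * t    ≡⟨ ℕ.+-comm 1 (2 * t) ⟩
  2 * t + 1    ∎
  where open ℕ.≤-Reasoning

odd-prime⇒%2≡1 : ∀ {p} → Prime p → p ≢ 2 → p % 2 ≡ 1
odd-prime⇒%2≡1 {p} p-prime p≢2 with p % 2 in p%2≡r | ℕ.m%n<n p 2
... | 1           | _                 = refl
... | suc (suc _) | s≤s (s≤s ())
... | 0           | _                 = ⊥-elim (prime⇒¬composite p-prime 2∣p)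
  where
  2∣p : Composite p
  2∣p = composite-≢ 2 {{_}} {{prime⇒nonZero p-prime}} (p≢2 ∘ sym) (ℕ.m%n≡0⇒n∣m p 2 p%2≡r)

-- Counting elements of a list that satisfy a Boolean predicate

count : {A : Set} → (A → Bool) → List A → ℕ
count P xs = length (filterᵇ P xs)

indicator : Bool → ℕ
indicator b = if b then 1 else 0

private variable
  A B : Set

count-∷ : (P : A → Bool) (x : A) (xs : List A) → count P (x ∷ xs) ≡ indicator (P x) + count P xs
count-∷ P x xs with P x
... | true  = refl
... | false = refl

count-cong : {P Q : A → Bool} (xs : List A) → (∀ x → P x ≡ Q x) → count P xs ≡ count Q xs
count-cong         []       P≗Q = refl
count-cong {P = P} {Q} (x ∷ xs) P≗Q = begin
  count P (x ∷ xs)               ≡⟨ count-∷ P x xs ⟩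
  indicator (P x) + count P xs   ≡⟨ cong₂ _+_ (cong indicator (P≗Q x)) (count-cong xs P≗Q) ⟩
  indicator (Q x) + count Q xs   ≡⟨ count-∷ Q x xs ⟨
  count Q (x ∷ xs)               ∎
  where open ≡-Reasoning

count-++ : (P : A → Bool) (xs ys : List A) → count P (xs ++ ys) ≡ count P xs + count P ys
count-++ P xs ys = trans (cong length (List.filter-++ _ xs ys)) (List.length-++ (filterᵇ P xs))

count-map : (P : B → Bool) (f : A → B) (xs : List A) → count P (map f xs) ≡ count (P ∘ f) xs
count-map P f []       = refl
count-map P f (x ∷ xs) = begin
  count P (f x ∷ map f xs)                  ≡⟨ count-∷ P (f x) (map f xs) ⟩
  indicator (P (f x)) + count P (map f xs)  ≡⟨ cong (λ n → indicator (P (f x)) + n) (count-map P f xs) ⟩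
  indicator (P (f x)) + count (P ∘ f) xs    ≡⟨ count-∷ (P ∘ f) x xs ⟨
  count (P ∘ f) (x ∷ xs)                    ∎
  where open ≡-Reasoning

count-none : (P : A → Bool) {xs : List A} → All (λ x → ¬ T (P x)) xs → count P xs ≡ 0
count-none P none = cong length (List.filter-none (T? ∘ P) none)

count-partition : (Q P : A → Bool) (xs : List A) →
  count P xs ≡ count (λ x → Q x ∧ P x) xs + count (λ x → not (Q x) ∧ P x) xs
count-partition Q P []       = refl
count-partition Q P (x ∷ xs) with Q x | P x
... | true  | true  = cong suc (count-partition Q P xs)
... | false | true  = trans (cong suc (count-partition Q P xs)) (sym (ℕ.+-suc _ _))
... | true  | false = count-partition Q P xs
... | false | false = count-partition Q P xs

count-∨ : (P Q : A → Bool) (xs : List A) → (∀ x → T (P x) → T (Q x) → ⊥) →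
  count (λ x → P x ∨ Q x) xs ≡ count P xs + count Q xs
count-∨ P Q []       disjoint = refl
count-∨ P Q (x ∷ xs) disjoint with P x | Q x | disjoint x
... | true  | true  | ¬both = ⊥-elim (¬both _ _)
... | true  | false | _     = cong suc (count-∨ P Q xs disjoint)
... | false | true  | _     = trans (cong suc (count-∨ P Q xs disjoint)) (sym (ℕ.+-suc _ _))
... | false | false | _     = count-∨ P Q xs disjoint

count-singleton : (P : A → Bool) {x : A} {xs : List A} → Unique xs → x ∈ xs →
  (∀ y → T (P y) ⇔ y ≡ x) → count P xs ≡ 1
count-singleton P {x} (x∉xs ∷ _) (here refl) P⇔≡x with P x | Equivalence.from (P⇔≡x x) refl
... | true | _ =
  cong suc (count-none P (All.map (λ x≢y Py → x≢y (sym (Equivalence.to (P⇔≡x _) Py))) x∉xs))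
count-singleton P {xs = y ∷ _} (y∉xs ∷ uniq) (there x∈xs) P⇔≡x with P y | Equivalence.to (P⇔≡x y)
... | true  | y≡x = ⊥-elim (All.lookup y∉xs x∈xs (y≡x _))
... | false | _   = count-singleton P uniq x∈xs P⇔≡x

count-∧-singleton : (Q P : A → Bool) {x : A} {xs : List A} → Unique xs → x ∈ xs →
  (∀ y → T (Q y) ⇔ y ≡ x) → count (λ y → Q y ∧ P y) xs ≡ indicator (P x)
count-∧-singleton Q P {x} {xs} uniq x∈xs Q⇔≡x with P x in Px
... | true  = count-singleton _ uniq x∈xs Q∧P⇔≡x
  where
  Q∧P⇔≡x : ∀ y → T (Q y ∧ P y) ⇔ y ≡ x
  Q∧P⇔≡x y = mk⇔ (λ Qy∧Py → Equivalence.to (Q⇔≡x y) (proj₁ (Equivalence.to Bool.T-∧ Qy∧Py)))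
                 (λ { refl → Equivalence.from Bool.T-∧ (Equivalence.from (Q⇔≡x x) refl , subst T (sym Px) _) })
... | false = count-none _ (All.universal ¬Q∧P xs)
  where
  ¬Q∧P : ∀ y → ¬ T (Q y ∧ P y)
  ¬Q∧P y Qy∧Py with refl ← Equivalence.to (Q⇔≡x y) (proj₁ (Equivalence.to Bool.T-∧ Qy∧Py)) =
    subst T Px (proj₂ (Equivalence.to Bool.T-∧ Qy∧Py))

count-cartesianProduct : (F : A × B → Bool) (xs : List A) (ys : List B) {k : ℕ} →
  (∀ a → count (λ b → F (a , b)) ys ≡ k) → count F (cartesianProduct xs ys) ≡ length xs * k
count-cartesianProduct F []       ys rows = refl
count-cartesianProduct F (x ∷ xs) ys rows =
  trans (count-++ F (map (x ,_) ys) (cartesianProduct xs ys))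
        (cong₂ _+_ (trans (count-map F (x ,_) ys) (rows x)) (count-cartesianProduct F xs ys rows))

count-allFin-≡ᵇ : ∀ {n k} → k < n → count (λ b → k ≡ᵇ toℕ b) (allFin n) ≡ 1
count-allFin-≡ᵇ {n} {k} k<n = count-singleton _ (allFin⁺ n) (∈-allFin (fromℕ< k<n)) k≡ᵇb⇔b≡k
  where
  k≡ᵇb⇔b≡k : ∀ b → T (k ≡ᵇ toℕ b) ⇔ b ≡ fromℕ< k<n
  k≡ᵇb⇔b≡k b = mk⇔
    (λ k≡b → toℕ-injective (trans (sym (ℕ.≡ᵇ⇒≡ k (toℕ b) k≡b)) (sym (toℕ-fromℕ< k<n))))
    (λ { refl → ℕ.≡⇒≡ᵇ k _ (sym (toℕ-fromℕ< k<n)) })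

count-allFin-any : ∀ {n} (f : A → ℕ) (L : List A) → All (λ i → f i < n) L →
  AllPairs (λ i j → f i ≢ f j) L → count (λ b → any (λ i → f i ≡ᵇ toℕ b) L) (allFin n) ≡ length L
count-allFin-any {n = n} f []      []           []                = count-none _ (All.universal (λ _ ()) (allFin n))
count-allFin-any {n = n} f (i ∷ L) (fi<n ∷ f<n) (fi≢f ∷ distinct) =
  trans (count-∨ (λ b → f i ≡ᵇ toℕ b) (λ b → any (λ j → f j ≡ᵇ toℕ b) L) (allFin n) disjoint)
        (cong₂ _+_ (count-allFin-≡ᵇ fi<n) (count-allFin-any f L f<n distinct))
  where
  disjoint : ∀ b → T (f i ≡ᵇ toℕ b) → T (any (λ j → f j ≡ᵇ toℕ b) L) → ⊥
  disjoint b fi≡b fj≡b = All.All¬⇒¬Any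
    (All.map (λ fi≢fj fj≡b → fi≢fj (trans (ℕ.≡ᵇ⇒≡ _ _ fi≡b) (sym (ℕ.≡ᵇ⇒≡ _ _ fj≡b)))) fi≢f)
    (any⁻ _ L fj≡b)

+indicator≡suc⇒≡ᵇ : ∀ d n c → d + indicator c ≡ suc n → (d ≡ᵇ n) ≡ c
+indicator≡suc⇒≡ᵇ d n true  d+1≡1+n =
  Equivalence.from (≡ᵇ≡true⇔≡ d n) (ℕ.suc-injective (trans (ℕ.+-comm 1 d) d+1≡1+n))
+indicator≡suc⇒≡ᵇ d n false d+0≡1+n = Bool.¬-not (λ d≡ᵇn →
  ℕ.1+n≢n (trans (sym d+0≡1+n) (trans (ℕ.+-identityʳ d) (Equivalence.to (≡ᵇ≡true⇔≡ d n) d≡ᵇn))))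

-- Congruences of integers

infix 4 _≡_mod_

record _≡_mod_ (a b : ℤ) (n : ℕ) : Set where
  constructor congruent
  field n∣a-b : + n ∣ a ℤ.- b

module _ {n : ℕ} where

  ≡-mod-via : ∀ {a b c} → c ≡ a ℤ.- b → + n ∣ c → a ≡ b mod n
  ≡-mod-via refl n∣c = congruent n∣c

  ≡⇒≡-mod : ∀ {a b} → a ≡ b → a ≡ b mod n
  ≡⇒≡-mod {a} refl = congruent (divides 0ℤ (ℤ.+-inverseʳ a))

  ≡-mod-sym : ∀ {a b} → a ≡ b mod n → b ≡ a mod n
  ≡-mod-sym {a} {b} (congruent a≡b) = ≡-mod-via (identity a b) (∣m⇒∣-m a≡b)
    where
    identity : ∀ a b → ℤ.- (a ℤ.- b) ≡ b ℤ.- a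
    identity = solve-∀

  ≡-mod-trans : ∀ {a b c} → a ≡ b mod n → b ≡ c mod n → a ≡ c mod n
  ≡-mod-trans {a} {b} {c} (congruent a≡b) (congruent b≡c) =
    ≡-mod-via (identity a b c) (∣m∣n⇒∣m+n a≡b b≡c)
    where
    identity : ∀ a b c → (a ℤ.- b) ℤ.+ (b ℤ.- c) ≡ a ℤ.- c
    identity = solve-∀

  ≡-mod-isEquivalence : IsEquivalence (_≡_mod n)
  ≡-mod-isEquivalence = record
    { refl  = ≡⇒≡-mod refl
    ; sym   = ≡-mod-sym
    ; trans = ≡-mod-trans
    }

  +-cong-mod : ∀ {a b c d} → a ≡ b mod n → c ≡ d mod n → a ℤ.+ c ≡ b ℤ.+ d mod n
  +-cong-mod {a} {b} {c} {d} (congruent a≡b) (congruent c≡d) =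
    ≡-mod-via (identity a b c d) (∣m∣n⇒∣m+n a≡b c≡d)
    where
    identity : ∀ a b c d → (a ℤ.- b) ℤ.+ (c ℤ.- d) ≡ (a ℤ.+ c) ℤ.- (b ℤ.+ d)
    identity = solve-∀

  *-cong-mod : ∀ {a b c d} → a ≡ b mod n → c ≡ d mod n → a ℤ.* c ≡ b ℤ.* d mod n
  *-cong-mod {a} {b} {c} {d} (congruent a≡b) (congruent c≡d) =
    ≡-mod-via (identity a b c d) (∣m∣n⇒∣m+n (∣m⇒∣m*n c a≡b) (∣n⇒∣m*n b c≡d))
    where
    identity : ∀ a b c d → (a ℤ.- b) ℤ.* c ℤ.+ b ℤ.* (c ℤ.- d) ≡ a ℤ.* c ℤ.- b ℤ.* d
    identity = solve-∀

  +-congˡ-mod : ∀ a {b c} → b ≡ c mod n → a ℤ.+ b ≡ a ℤ.+ c mod n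
  +-congˡ-mod a = +-cong-mod (≡⇒≡-mod {a = a} refl)

  +-congʳ-mod : ∀ c {a b} → a ≡ b mod n → a ℤ.+ c ≡ b ℤ.+ c mod n
  +-congʳ-mod c a≡b = +-cong-mod a≡b (≡⇒≡-mod {a = c} refl)

  *-congˡ-mod : ∀ a {b c} → b ≡ c mod n → a ℤ.* b ≡ a ℤ.* c mod n
  *-congˡ-mod a = *-cong-mod (≡⇒≡-mod {a = a} refl)

  *-congʳ-mod : ∀ c {a b} → a ≡ b mod n → a ℤ.* c ≡ b ℤ.* c mod n
  *-congʳ-mod c a≡b = *-cong-mod a≡b (≡⇒≡-mod {a = c} refl)

  -‿cong-mod : ∀ {a b} → a ≡ b mod n → ℤ.- a ≡ ℤ.- b mod n
  -‿cong-mod {a} {b} (congruent a≡b) = ≡-mod-via (identity a b) (∣m⇒∣-m a≡b)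
    where
    identity : ∀ a b → ℤ.- (a ℤ.- b) ≡ ℤ.- a ℤ.- ℤ.- b
    identity = solve-∀

  +-cancelʳ-mod : ∀ {a b} c → a ℤ.+ c ≡ b ℤ.+ c mod n → a ≡ b mod n
  +-cancelʳ-mod {a} {b} c (congruent a+c≡b+c) = ≡-mod-via (identity a b c) a+c≡b+c
    where
    identity : ∀ a b c → (a ℤ.+ c) ℤ.- (b ℤ.+ c) ≡ a ℤ.- b
    identity = solve-∀

  +-cancelˡ-mod : ∀ a {b c} → a ℤ.+ b ≡ a ℤ.+ c mod n → b ≡ c mod n
  +-cancelˡ-mod a {b} {c} a+b≡a+c =
    +-cancelʳ-mod a (subst₂ (_≡_mod n) (ℤ.+-comm a b) (ℤ.+-comm a c) a+b≡a+c)

  +-multiple-mod : ∀ a k → a ℤ.+ k ℤ.* + n ≡ a mod n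
  +-multiple-mod a k = ≡-mod-via (identity a k (+ n)) (divides k refl)
    where
    identity : ∀ a k n → k ℤ.* n ≡ (a ℤ.+ k ℤ.* n) ℤ.- a
    identity = solve-∀

≡-mod-setoid : ℕ → Setoid 0ℓ 0ℓ
≡-mod-setoid n = record { isEquivalence = ≡-mod-isEquivalence {n} }

module ≡-mod-Reasoning (n : ℕ) = Relation.Binary.Reasoning.Setoid (≡-mod-setoid n)

a-b≡0⇒a≡b-mod : ∀ {n a b} → a ℤ.- b ≡ 0ℤ mod n → a ≡ b mod n
a-b≡0⇒a≡b-mod {n} {a} {b} (congruent n∣a-b-0) = ≡-mod-via (ℤ.+-identityʳ (a ℤ.- b)) n∣a-b-0

a≡b⇒a-b≡0-mod : ∀ {n a b} → a ≡ b mod n → a ℤ.- b ≡ 0ℤ mod n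
a≡b⇒a-b≡0-mod {n} {a} {b} (congruent n∣a-b) = ≡-mod-via (sym (ℤ.+-identityʳ (a ℤ.- b))) n∣a-b

%-≡-mod : ∀ m n .{{_ : NonZero n}} → + (m % n) ≡ + m mod n
%-≡-mod m n = begin
  + (m % n)                          ≈⟨ ≡-mod-sym (+-multiple-mod (+ (m % n)) (+ (m / n))) ⟩
  + (m % n) ℤ.+ + (m / n) ℤ.* + n    ≡⟨ cong (λ x → + (m % n) ℤ.+ x) (ℤ.pos-* (m / n) n) ⟨
  + (m % n + m / n * n)              ≡⟨ cong +_ (ℕ.m≡m%n+[m/n]*n m n) ⟨
  + m                                ∎
  where open ≡-mod-Reasoning n

%ℕ-≡-mod : ∀ i n .{{_ : NonZero n}} → + (i %ℕ n) ≡ i mod n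
%ℕ-≡-mod i n = begin
  + (i %ℕ n)                         ≈⟨ ≡-mod-sym (+-multiple-mod (+ (i %ℕ n)) (i /ℕ n)) ⟩
  + (i %ℕ n) ℤ.+ (i /ℕ n) ℤ.* + n    ≡⟨ ℤ.a≡a%ℕn+[a/ℕn]*n i n ⟨
  i                                  ∎
  where open ≡-mod-Reasoning n

%ℕ≡⇒≡-mod : ∀ i j n .{{_ : NonZero n}} → i %ℕ n ≡ j %ℕ n → i ≡ j mod n
%ℕ≡⇒≡-mod i j n i%n≡j%n = begin
  i            ≈⟨ %ℕ-≡-mod i n ⟨
  + (i %ℕ n)   ≡⟨ cong +_ i%n≡j%n ⟩
  + (j %ℕ n)   ≈⟨ %ℕ-≡-mod j n ⟩
  j            ∎
  where open ≡-mod-Reasoning n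

mod'-≡-mod : ∀ m n → + (m mod' n) ≡ + m mod n
mod'-≡-mod m zero    = ≡⇒≡-mod refl
mod'-≡-mod m (suc n) = %-≡-mod m (suc n)

mod'-< : ∀ m n .{{_ : NonZero n}} → m mod' n < n
mod'-< m (suc n) = ℕ.m%n<n m (suc n)

≡-mod-weaken : ∀ {a b} m k → a ≡ b mod (m * k) → a ≡ b mod m
≡-mod-weaken {a} {b} m k (congruent (divides c a-b≡c*mk)) = congruent (divides (c ℤ.* + k) (begin
  a ℤ.- b                 ≡⟨ a-b≡c*mk ⟩
  c ℤ.* + (m * k)         ≡⟨ cong (c ℤ.*_) (ℤ.pos-* m k) ⟩
  c ℤ.* (+ m ℤ.* + k)     ≡⟨ cong (c ℤ.*_) (ℤ.*-comm (+ m) (+ k)) ⟩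
  c ℤ.* (+ k ℤ.* + m)     ≡⟨ ℤ.*-assoc c (+ k) (+ m) ⟨
  c ℤ.* + k ℤ.* + m       ∎))
  where open ≡-Reasoning

small-multiple≡0 : ∀ {n m} → n ℕ.∣ m → m < n → m ≡ 0
small-multiple≡0 {m = zero}  _   _   = refl
small-multiple≡0 {m = suc m} n∣m m<n = ⊥-elim (ℕ.>⇒∤ m<n n∣m)

≤∧≡-mod⇒≡ : ∀ {n a b} → a ≤ b → b < n → + a ≡ + b mod n → a ≡ b
≤∧≡-mod⇒≡ {n} {a} {b} a≤b b<n (congruent n∣a-b) =
  ℕ.≤-antisym a≤b (ℕ.m∸n≡0⇒m≤n (small-multiple≡0 n∣b∸a (ℕ.≤-<-trans (ℕ.m∸n≤m b a) b<n)))
  where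
  n∣b∸a : n ℕ.∣ b ∸ a
  n∣b∸a = subst (n ℕ.∣_) (trans (cong ∣_∣ (ℤ.m-n≡m⊖n a b)) (ℤ.∣⊖∣-≤ a≤b))
                (∣⇒∣ᵤ n∣a-b)

≡-mod⇒≡ : ∀ {n a b} → a < n → b < n → + a ≡ + b mod n → a ≡ b
≡-mod⇒≡ {a = a} {b} a<n b<n a≡b with ℕ.≤-total a b
... | inj₁ a≤b = ≤∧≡-mod⇒≡ a≤b b<n a≡b
... | inj₂ b≤a = sym (≤∧≡-mod⇒≡ b≤a a<n (≡-mod-sym a≡b))

≡-mod⇒%≡ : ∀ {a b} n .{{_ : NonZero n}} → + a ≡ + b mod n → a % n ≡ b % n
≡-mod⇒%≡ {a} {b} n a≡b = ≡-mod⇒≡ (ℕ.m%n<n a n) (ℕ.m%n<n b n) (begin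
  + (a % n)   ≈⟨ %-≡-mod a n ⟩
  + a         ≈⟨ a≡b ⟩
  + b         ≈⟨ %-≡-mod b n ⟨
  + (b % n)   ∎)
  where open ≡-mod-Reasoning n

≡-mod⇒Fin-≡ : ∀ {n} {i j : Fin n} → + toℕ i ≡ + toℕ j mod n → i ≡ j
≡-mod⇒Fin-≡ i≡j = toℕ-injective (≡-mod⇒≡ (toℕ<n _) (toℕ<n _) i≡j)

∣⇒≡0-mod : ∀ {n a} → + n ∣ a → a ≡ 0ℤ mod n
∣⇒≡0-mod {a = a} n∣a = ≡-mod-via (sym (ℤ.+-identityʳ a)) n∣a

≡0-mod⇒∣ : ∀ {n a} → a ≡ 0ℤ mod n → + n ∣ a
≡0-mod⇒∣ {a = a} (congruent n∣a-0) = subst (_ ∣_) (ℤ.+-identityʳ a) n∣a-0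

prime-mod-product : ∀ {p a b} → Prime p → a ℤ.* b ≡ 0ℤ mod p → a ≡ 0ℤ mod p ⊎ b ≡ 0ℤ mod p
prime-mod-product {p} {a} {b} p-prime ab≡0 with euclidsLemma ∣ a ∣ ∣ b ∣ p-prime p∣∣a∣∣b∣
  where
  p∣∣a∣∣b∣ : p ℕ.∣ ∣ a ∣ * ∣ b ∣
  p∣∣a∣∣b∣ = subst (p ℕ.∣_) (ℤ.abs-* a b) (∣⇒∣ᵤ (≡0-mod⇒∣ ab≡0))
... | inj₁ p∣a = inj₁ (∣⇒≡0-mod (∣ᵤ⇒∣ p∣a))
... | inj₂ p∣b = inj₂ (∣⇒≡0-mod (∣ᵤ⇒∣ p∣b))

*-cancelˡ-mod : ∀ {p c a b} → Prime p → ¬ (c ≡ 0ℤ mod p) →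
  c ℤ.* a ≡ c ℤ.* b mod p → a ≡ b mod p
*-cancelˡ-mod {p} {c} {a} {b} p-prime c≢0 ca≡cb with prime-mod-product p-prime c[a-b]≡0
  where
  identity : ∀ c a b → c ℤ.* (a ℤ.- b) ≡ c ℤ.* a ℤ.- c ℤ.* b
  identity = solve-∀
  c[a-b]≡0 : c ℤ.* (a ℤ.- b) ≡ 0ℤ mod p
  c[a-b]≡0 = subst (_≡ 0ℤ mod p) (sym (identity c a b)) (a≡b⇒a-b≡0-mod ca≡cb)
... | inj₁ c≡0   = ⊥-elim (c≢0 c≡0)
... | inj₂ a-b≡0 = a-b≡0⇒a≡b-mod a-b≡0

quadratic-roots : ∀ {p} b b′ β γ → Prime p →
  b ℤ.* b ℤ.+ β ℤ.* b ℤ.+ γ ≡ 0ℤ mod p → b′ ℤ.* b′ ℤ.+ β ℤ.* b′ ℤ.+ γ ≡ 0ℤ mod p →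
  b ≡ b′ mod p ⊎ b ℤ.+ b′ ≡ ℤ.- β mod p
quadratic-roots {p} b b′ β γ p-prime fb≡0 fb′≡0 with prime-mod-product p-prime [b-b′][b+b′+β]≡0
  where
  identity : ∀ b b′ β γ → (b ℤ.- b′) ℤ.* (b ℤ.+ b′ ℤ.+ β) ≡
    (b ℤ.* b ℤ.+ β ℤ.* b ℤ.+ γ) ℤ.- (b′ ℤ.* b′ ℤ.+ β ℤ.* b′ ℤ.+ γ)
  identity = solve-∀
  [b-b′][b+b′+β]≡0 : (b ℤ.- b′) ℤ.* (b ℤ.+ b′ ℤ.+ β) ≡ 0ℤ mod p
  [b-b′][b+b′+β]≡0 =
    subst (_≡ 0ℤ mod p) (sym (identity b b′ β γ))
          (a≡b⇒a-b≡0-mod (≡-mod-trans fb≡0 (≡-mod-sym fb′≡0)))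
... | inj₁ b-b′≡0   = inj₁ (a-b≡0⇒a≡b-mod b-b′≡0)
... | inj₂ b+b′+β≡0 = inj₂ (a-b≡0⇒a≡b-mod (subst (_≡ 0ℤ mod p) (identity′ b b′ β) b+b′+β≡0))
  where
  identity′ : ∀ b b′ β → b ℤ.+ b′ ℤ.+ β ≡ b ℤ.+ b′ ℤ.- ℤ.- β
  identity′ = solve-∀

ℕ-*-cong-mod : ∀ {n a b c d} → + a ≡ + b mod n → + c ≡ + d mod n → + (a * c) ≡ + (b * d) mod n
ℕ-*-cong-mod {a = a} {b} {c} {d} a≡b c≡d =
  subst₂ (_≡_mod _) (sym (ℤ.pos-* a c)) (sym (ℤ.pos-* b d)) (*-cong-mod a≡b c≡d)

^-cong-mod : ∀ {n a b} → + a ≡ + b mod n → ∀ k → + (a ^ k) ≡ + (b ^ k) mod n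
^-cong-mod a≡b zero    = ≡⇒≡-mod refl
^-cong-mod a≡b (suc k) = ℕ-*-cong-mod a≡b (^-cong-mod a≡b k)

module AffineBijection {p : ℕ} .{{_ : NonZero p}} (f : ℕ → ℕ) (c k k⁻¹ : ℤ) (f<p : ∀ b → f b < p)
  (f≡c+kb : ∀ b → + f b ≡ c ℤ.+ k ℤ.* + b mod p) (kk⁻¹≡1 : k ℤ.* k⁻¹ ≡ + 1 mod p) where

  ψ : ℕ → ℕ
  ψ v = (k⁻¹ ℤ.* (+ v ℤ.- c)) %ℕ p

  ψ<p : ∀ v → ψ v < p
  ψ<p v = ℤ.n%ℕd<d (k⁻¹ ℤ.* (+ v ℤ.- c)) p

  ψ∘f≡id : ∀ {b} → b < p → ψ (f b) ≡ b
  ψ∘f≡id {b} b<p = ≡-mod⇒≡ (ψ<p (f b)) b<p (begin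
    + ψ (f b)                          ≈⟨ %ℕ-≡-mod (k⁻¹ ℤ.* (+ f b ℤ.- c)) p ⟩
    k⁻¹ ℤ.* (+ f b ℤ.- c)              ≈⟨ *-congˡ-mod k⁻¹ (+-congʳ-mod (ℤ.- c) (f≡c+kb b)) ⟩
    k⁻¹ ℤ.* (c ℤ.+ k ℤ.* + b ℤ.- c)    ≡⟨ identity k⁻¹ c k (+ b) ⟩
    (k ℤ.* k⁻¹) ℤ.* + b                ≈⟨ *-congʳ-mod (+ b) kk⁻¹≡1 ⟩
    + 1 ℤ.* + b                        ≡⟨ ℤ.*-identityˡ (+ b) ⟩
    + b                                ∎)
    where
    open ≡-mod-Reasoning p
    identity : ∀ k⁻¹ c k b → k⁻¹ ℤ.* (c ℤ.+ k ℤ.* b ℤ.- c) ≡ (k ℤ.* k⁻¹) ℤ.* b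
    identity = solve-∀

  f∘ψ≡id : ∀ {v} → v < p → f (ψ v) ≡ v
  f∘ψ≡id {v} v<p = ≡-mod⇒≡ (f<p (ψ v)) v<p (begin
    + f (ψ v)                            ≈⟨ f≡c+kb (ψ v) ⟩
    c ℤ.+ k ℤ.* + ψ v                    ≈⟨ +-congˡ-mod c (*-congˡ-mod k (%ℕ-≡-mod r p)) ⟩
    c ℤ.+ k ℤ.* (k⁻¹ ℤ.* (+ v ℤ.- c))    ≡⟨ identity c k k⁻¹ (+ v) ⟩
    c ℤ.+ (k ℤ.* k⁻¹) ℤ.* (+ v ℤ.- c)    ≈⟨ +-congˡ-mod c (*-congʳ-mod (+ v ℤ.- c) kk⁻¹≡1) ⟩
    c ℤ.+ + 1 ℤ.* (+ v ℤ.- c)            ≡⟨ identity′ c (+ v) ⟩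
    + v                                  ∎)
    where
    open ≡-mod-Reasoning p
    r : ℤ
    r = k⁻¹ ℤ.* (+ v ℤ.- c)
    identity : ∀ c k k⁻¹ v →
      c ℤ.+ k ℤ.* (k⁻¹ ℤ.* (v ℤ.- c)) ≡ c ℤ.+ (k ℤ.* k⁻¹) ℤ.* (v ℤ.- c)
    identity = solve-∀
    identity′ : ∀ c v → c ℤ.+ + 1 ℤ.* (v ℤ.- c) ≡ v
    identity′ = solve-∀

  ≡f⇔ψ≡ : ∀ {v b} → v < p → b < p → v ≡ f b ⇔ ψ v ≡ b
  ≡f⇔ψ≡ v<p b<p = mk⇔ (λ { refl → ψ∘f≡id b<p }) (λ { refl → sym (f∘ψ≡id v<p) })

  ψ-injective : ∀ {v v′} → v < p → v′ < p → ψ v ≡ ψ v′ → v ≡ v′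
  ψ-injective {v} {v′} v<p v′<p ψv≡ψv′ = begin
    v          ≡⟨ f∘ψ≡id v<p ⟨
    f (ψ v)    ≡⟨ cong f ψv≡ψv′ ⟩
    f (ψ v′)   ≡⟨ f∘ψ≡id v′<p ⟩
    v′         ∎
    where open ≡-Reasoning

2*[1+p/2]≡1-mod : ∀ {p} → Prime p → p ≢ 2 → + 2 ℤ.* + suc (p / 2) ≡ + 1 mod p
2*[1+p/2]≡1-mod {p} p-prime p≢2 = begin
  + 2 ℤ.* + suc (p / 2)        ≡⟨ ℤ.pos-* 2 (suc (p / 2)) ⟨
  + (2 * suc (p / 2))          ≡⟨ cong +_ (ℕ.*-suc 2 (p / 2)) ⟩
  + (2 + 2 * (p / 2))          ≡⟨ cong (λ n → + (2 + n)) (ℕ.*-comm 2 (p / 2)) ⟩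
  + (2 + p / 2 * 2)            ≡⟨ cong (λ r → + (1 + (r + p / 2 * 2))) (odd-prime⇒%2≡1 p-prime p≢2) ⟨
  + (1 + (p % 2 + p / 2 * 2))  ≡⟨ cong (λ n → + (1 + n)) (ℕ.m≡m%n+[m/n]*n p 2) ⟨
  + 1 ℤ.+ + p                  ≡⟨ cong (λ x → + 1 ℤ.+ x) (ℤ.*-identityˡ (+ p)) ⟨
  + 1 ℤ.+ + 1 ℤ.* + p          ≈⟨ +-multiple-mod (+ 1) (+ 1) ⟩
  + 1                          ∎
  where open ≡-mod-Reasoning p

module QuadraticRoots {p : ℕ} .{{_ : NonZero p}} (p-prime : Prime p) where

  -- b is a root of X² + 2(y - T) X + y² over 𝔽ₚ.
  IsRoot : (y T b : ℕ) → Set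
  IsRoot y T b = + T ℤ.* (+ b ℤ.+ + b) ≡ (+ y ℤ.+ + b) ℤ.* (+ y ℤ.+ + b) mod p

  other-root : (y T b : ℕ) → ℕ
  other-root y T b = (+ T ℤ.+ + T ℤ.- + y ℤ.- + y ℤ.- + b) %ℕ p

  private
    β : ℕ → ℕ → ℤ
    β y T = + y ℤ.+ + y ℤ.- + T ℤ.- + T

    IsRoot⇒≡0 : ∀ {y T b} → IsRoot y T b → + b ℤ.* + b ℤ.+ β y T ℤ.* + b ℤ.+ + y ℤ.* + y ≡ 0ℤ mod p
    IsRoot⇒≡0 {y} {T} {b} root =
      subst (_≡ 0ℤ mod p) (identity (+ y) (+ T) (+ b)) (a≡b⇒a-b≡0-mod (≡-mod-sym root))
      where
      identity : ∀ y T b → (y ℤ.+ b) ℤ.* (y ℤ.+ b) ℤ.- T ℤ.* (b ℤ.+ b) ≡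
        b ℤ.* b ℤ.+ (y ℤ.+ y ℤ.- T ℤ.- T) ℤ.* b ℤ.+ y ℤ.* y
      identity = solve-∀

    other-root≡ : ∀ {y T b b′} → b′ < p → + b ℤ.+ + b′ ≡ ℤ.- β y T mod p → other-root y T b ≡ b′
    other-root≡ {y} {T} {b} {b′} b′<p b+b′≡-β = ≡-mod⇒≡ (ℤ.n%ℕd<d r p) b′<p (begin
      + other-root y T b        ≈⟨ %ℕ-≡-mod r p ⟩
      r                         ≡⟨ identity (+ y) (+ T) (+ b) ⟩
      ℤ.- β y T ℤ.- + b         ≈⟨ +-congʳ-mod (ℤ.- + b) (≡-mod-sym b+b′≡-β) ⟩
      (+ b ℤ.+ + b′) ℤ.- + b    ≡⟨ identity′ (+ b) (+ b′) ⟩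
      + b′                      ∎)
      where
      open ≡-mod-Reasoning p
      r : ℤ
      r = + T ℤ.+ + T ℤ.- + y ℤ.- + y ℤ.- + b
      identity : ∀ y T b → T ℤ.+ T ℤ.- y ℤ.- y ℤ.- b ≡ ℤ.- (y ℤ.+ y ℤ.- T ℤ.- T) ℤ.- b
      identity = solve-∀
      identity′ : ∀ b b′ → (b ℤ.+ b′) ℤ.- b ≡ b′
      identity′ = solve-∀

  root-determined-by-order : ∀ {y T b b′} → b < p → b′ < p → IsRoot y T b → IsRoot y T b′ →
    (b <ᵇ other-root y T b) ≡ (b′ <ᵇ other-root y T b′) → b ≡ b′
  root-determined-by-order {y} {T} {b} {b′} b<p b′<p root root′ order =
    [ ≡-mod⇒≡ b<p b′<p , by-order ]′
      (quadratic-roots (+ b) (+ b′) (β y T) (+ y ℤ.* + y) p-prime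
                       (IsRoot⇒≡0 {y} {T} {b} root) (IsRoot⇒≡0 {y} {T} {b′} root′))
    where
    by-order : + b ℤ.+ + b′ ≡ ℤ.- β y T mod p → b ≡ b′
    by-order b+b′≡-β = <ᵇ-flip⇒≡ b b′ (begin
      b <ᵇ b′                   ≡⟨ cong (b <ᵇ_) (other-root≡ {y} {T} b′<p b+b′≡-β) ⟨
      b <ᵇ other-root y T b     ≡⟨ order ⟩
      b′ <ᵇ other-root y T b′   ≡⟨ cong (b′ <ᵇ_) (other-root≡ {y} {T} b<p b′+b≡-β) ⟩
      b′ <ᵇ b                   ∎)
      where
      open ≡-Reasoning
      b′+b≡-β : + b′ ℤ.+ + b ≡ ℤ.- β y T mod p
      b′+b≡-β = subst (_≡ ℤ.- β y T mod p) (ℤ.+-comm (+ b) (+ b′)) b+b′≡-β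

-- Powers of a generator of the multiplicative group of 𝔽ₚ

module _ {p θ : ℕ} (p-prime : Prime p) (gen : IsGenerator p θ) where

  private instance
    p≢0 : NonZero p
    p≢0 = prime⇒nonZero p-prime
    p-1≢0 : NonZero (p ∸ 1)
    p-1≢0 = >-nonZero (ℕ.m<n⇒0<n∸m (nonTrivial⇒n>1 p {{prime⇒nonTrivial p-prime}}))

  private
    1<p : 1 < p
    1<p = nonTrivial⇒n>1 p {{prime⇒nonTrivial p-prime}}

    1≢0-mod : ¬ (+ 1 ≡ 0ℤ mod p)
    1≢0-mod 1≡0 with () ← ≡-mod⇒≡ 1<p (ℕ.<-trans z<s 1<p) 1≡0

  θ^[p-1]≡1 : + (θ ^ (p ∸ 1)) ≡ + 1 mod p
  θ^[p-1]≡1 = ≡-mod-trans (≡-mod-sym (mod'-≡-mod _ p)) (≡⇒≡-mod (cong +_ (proj₁ (proj₂ gen))))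

  θ^k≢0 : ∀ k → ¬ (+ (θ ^ k) ≡ 0ℤ mod p)
  θ^k≢0 zero    = 1≢0-mod
  θ^k≢0 (suc k) θ^[1+k]≡0
    with prime-mod-product p-prime (subst (_≡ 0ℤ mod p) (ℤ.pos-* θ (θ ^ k)) θ^[1+k]≡0)
  ... | inj₁ θ≡0   = 1≢0-mod (begin
    + 1                      ≈⟨ ≡-mod-sym θ^[p-1]≡1 ⟩
    + (θ ^ (p ∸ 1))          ≈⟨ ^-cong-mod θ≡0 (p ∸ 1) ⟩
    + (0 ^ (p ∸ 1))          ≡⟨ cong (λ e → + (0 ^ e)) (ℕ.suc-pred (p ∸ 1)) ⟨
    + (0 ^ suc (pred (p ∸ 1))) ∎)
    where open ≡-mod-Reasoning p
  ... | inj₂ θ^k≡0 = θ^k≢0 k θ^k≡0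

  private
    no-short-cycle : ∀ {i j} → i < j → j < p ∸ 1 → ¬ (+ (θ ^ i) ≡ + (θ ^ j) mod p)
    no-short-cycle {i} {j} i<j j<p-1 θⁱ≡θʲ =
      proj₂ (proj₂ gen) (j ∸ i) (ℕ.m<n⇒0<n∸m i<j) (ℕ.≤-<-trans (ℕ.m∸n≤m j i) j<p-1)
        (≡-mod⇒≡ (mod'-< _ p) 1<p (≡-mod-trans (mod'-≡-mod _ p) θ^[j-i]≡1))
      where
      θ^[j-i]≡1 : + (θ ^ (j ∸ i)) ≡ + 1 mod p
      θ^[j-i]≡1 = ≡-mod-sym (*-cancelˡ-mod p-prime (θ^k≢0 i) (begin
        + (θ ^ i) ℤ.* + 1                ≡⟨ ℤ.*-identityʳ _ ⟩
        + (θ ^ i)                        ≈⟨ θⁱ≡θʲ ⟩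
        + (θ ^ j)                        ≡⟨ cong (λ e → + (θ ^ e)) (ℕ.m+[n∸m]≡n (ℕ.<⇒≤ i<j)) ⟨
        + (θ ^ (i + (j ∸ i)))            ≡⟨ cong +_ (ℕ.^-distribˡ-+-* θ i (j ∸ i)) ⟩
        + (θ ^ i * θ ^ (j ∸ i))          ≡⟨ ℤ.pos-* (θ ^ i) _ ⟩
        + (θ ^ i) ℤ.* + (θ ^ (j ∸ i))    ∎))
        where open ≡-mod-Reasoning p

  θ^-injective : ∀ {i j} → i < p ∸ 1 → j < p ∸ 1 → + (θ ^ i) ≡ + (θ ^ j) mod p → i ≡ j
  θ^-injective {i} {j} i<p-1 j<p-1 θⁱ≡θʲ with ℕ.<-cmp i j
  ... | tri≈ _ i≡j _ = i≡j
  ... | tri< i<j _ _ = ⊥-elim (no-short-cycle i<j j<p-1 θⁱ≡θʲ)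
  ... | tri> _ _ j<i = ⊥-elim (no-short-cycle j<i i<p-1 (≡-mod-sym θⁱ≡θʲ))

  θ^-% : ∀ i → + (θ ^ i) ≡ + (θ ^ (i % (p ∸ 1))) mod p
  θ^-% i = begin
    + (θ ^ i)                          ≡⟨ cong +_ (^-%-/ θ (p ∸ 1) i) ⟩
    + (θ ^ r * (θ ^ (p ∸ 1)) ^ k)      ≈⟨ ℕ-*-cong-mod {a = θ ^ r} (≡⇒≡-mod refl) (^-cong-mod θ^[p-1]≡1 k) ⟩
    + (θ ^ r * 1 ^ k)                  ≡⟨ cong (λ x → + (θ ^ r * x)) (ℕ.^-zeroˡ k) ⟩
    + (θ ^ r * 1)                      ≡⟨ cong +_ (ℕ.*-identityʳ (θ ^ r)) ⟩
    + (θ ^ r)                          ∎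
    where
    open ≡-mod-Reasoning p
    r k : ℕ
    r = i % (p ∸ 1)
    k = i / (p ∸ 1)

  θ^-cong : ∀ {i j} → + i ≡ + j mod (p ∸ 1) → + (θ ^ i) ≡ + (θ ^ j) mod p
  θ^-cong {i} {j} i≡j = begin
    + (θ ^ i)                  ≈⟨ θ^-% i ⟩
    + (θ ^ (i % (p ∸ 1)))      ≡⟨ cong (λ e → + (θ ^ e)) (≡-mod⇒%≡ (p ∸ 1) i≡j) ⟩
    + (θ ^ (j % (p ∸ 1)))      ≈⟨ θ^-% j ⟨
    + (θ ^ j)                  ∎
    where open ≡-mod-Reasoning p

-- Common neighbours

CommonNeighbour : {V : Set} → (V → V → Bool) → V → V → Set
CommonNeighbour {V} adj u₁ u₂ = Σ V λ w → T (adj u₁ w) × T (adj u₂ w)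

record CommonNeighbourCode {V : Set} (adj : V → V → Bool) (u₁ u₂ : V) (k : ℕ) : Set where
  field
    code           : CommonNeighbour adj u₁ u₂ → Fin k
    code-injective : ∀ c c′ → code c ≡ code c′ → proj₁ c ≡ proj₁ c′

CommonNeighbourCode-swap : ∀ {V : Set} {adj : V → V → Bool} {u₁ u₂ k} →
  CommonNeighbourCode adj u₁ u₂ k → CommonNeighbourCode adj u₂ u₁ k
CommonNeighbourCode-swap C = record
  { code           = λ (w , h₁ , h₂) → code (w , h₂ , h₁)
  ; code-injective = λ (w , h₁ , h₂) (w′ , h₁′ , h₂′) →
                       code-injective (w , h₂ , h₁) (w′ , h₂′ , h₁′)
  }
  where open CommonNeighbourCode C

codes⇒¬ContainsK2 : {V : Set} (adj : V → V → Bool) (s : ℕ) →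
  (∀ {u₁ u₂} → u₁ ≢ u₂ → Σ ℕ λ k → k < s × CommonNeighbourCode adj u₁ u₂ k) →
  ¬ ContainsK2 V adj s
codes⇒¬ContainsK2 adj s codes (u₁ , u₂ , u₁≢u₂ , f , f-injective , f-common) =
  pigeonhole (codes u₁≢u₂)
  where
  common : ∀ i → CommonNeighbour adj u₁ u₂
  common i = f i , proj₁ (proj₂ (proj₂ (f-common i))) , proj₂ (proj₂ (proj₂ (f-common i)))
  pigeonhole : ¬ (Σ ℕ λ k → k < s × CommonNeighbourCode adj u₁ u₂ k)
  pigeonhole (k , k<s , C) =
    <⇒notInjective k<s (λ {i} {j} cᵢ≡cⱼ → f-injective (code-injective (common i) (common j) cᵢ≡cⱼ))
    where open CommonNeighbourCode C

-- The graph H*ₚ,ₜ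

module SumGraph {p q t θ : ℕ} (p-prime : Prime p) (q*t≡p-1 : q * t ≡ p ∸ 1) (gen : IsGenerator p θ) where

  private instance
    p≢0 : NonZero p
    p≢0 = prime⇒nonZero p-prime
    p-1≢0 : NonZero (p ∸ 1)
    p-1≢0 = >-nonZero (ℕ.m<n⇒0<n∸m (nonTrivial⇒n>1 p {{prime⇒nonTrivial p-prime}}))
    q≢0 : NonZero q
    q≢0 = ℕ.m*n≢0⇒m≢0 q {{subst NonZero (sym q*t≡p-1) p-1≢0}}

  open QuadraticRoots p-prime

  record Log (m y : ℕ) : Set where
    field
      log     : ℕ
      log<p-1 : log < p ∸ 1
      log≡m   : + log ≡ + m mod q
      θ^log≡y : + (θ ^ log) ≡ + y mod p

  θ^m[θ^q]^n≡θ^[m+q*n] : ∀ m n → θ ^ m * (θ ^ q) ^ n ≡ θ ^ (m + q * n)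
  θ^m[θ^q]^n≡θ^[m+q*n] m n =
    trans (cong (θ ^ m *_) (ℕ.^-*-assoc θ q n)) (sym (ℕ.^-distribˡ-+-* θ m (q * n)))

  exponent<p-1 : ∀ {m n} → m < q → n < t → m + q * n < p ∸ 1
  exponent<p-1 {m} {n} m<q n<t = subst (m + q * n <_) q*t≡p-1 (m<q⇒n<t⇒m+q*n<q*t m<q n<t)

  S-value : ℕ → ℕ → ℕ
  S-value m n = (θ ^ m * (θ ^ q) ^ n) mod' p

  inS⇒Log : ∀ m y → T (inS p q t θ (m mod' q) (y mod' p)) → Log m y
  inS⇒Log m y m,y∈S with find (any⁻ _ (upTo t) m,y∈S)
  ... | n , n∈upTo , sₙ≡ᵇy = record
    { log     = m mod' q + q * n
    ; log<p-1 = exponent<p-1 (mod'-< m q) (∈-upTo⁻ n∈upTo)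
    ; log≡m   = let open ≡-mod-Reasoning q in begin
        + (m mod' q + q * n)          ≡⟨ cong (λ x → + (m mod' q) ℤ.+ x) (ℤ.pos-* q n) ⟩
        + (m mod' q) ℤ.+ + q ℤ.* + n  ≡⟨ cong (λ x → + (m mod' q) ℤ.+ x) (ℤ.*-comm (+ q) (+ n)) ⟩
        + (m mod' q) ℤ.+ + n ℤ.* + q  ≈⟨ +-multiple-mod (+ (m mod' q)) (+ n) ⟩
        + (m mod' q)                  ≈⟨ mod'-≡-mod m q ⟩
        + m                           ∎
    ; θ^log≡y = let open ≡-mod-Reasoning p in begin
        + (θ ^ (m mod' q + q * n))          ≡⟨ cong +_ (θ^m[θ^q]^n≡θ^[m+q*n] (m mod' q) n) ⟨
        + (θ ^ (m mod' q) * (θ ^ q) ^ n)    ≈⟨ mod'-≡-mod _ p ⟨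
        + S-value (m mod' q) n              ≡⟨ cong +_ (ℕ.≡ᵇ⇒≡ _ _ sₙ≡ᵇy) ⟩
        + (y mod' p)                        ≈⟨ mod'-≡-mod y p ⟩
        + y                                 ∎
    }

  open Log

  Log-injective : ∀ {m y m′ y′} (ℓ : Log m y) (ℓ′ : Log m′ y′) →
    + y ≡ + y′ mod p → log ℓ ≡ log ℓ′
  Log-injective ℓ ℓ′ y≡y′ = θ^-injective p-prime gen (log<p-1 ℓ) (log<p-1 ℓ′)
    (≡-mod-trans (θ^log≡y ℓ) (≡-mod-trans y≡y′ (≡-mod-sym (θ^log≡y ℓ′))))

  Log-determines-m : ∀ {m y m′ y′} (ℓ : Log m y) (ℓ′ : Log m′ y′) →
    + y ≡ + y′ mod p → + m ≡ + m′ mod q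
  Log-determines-m ℓ ℓ′ y≡y′ = begin
    + _         ≈⟨ log≡m ℓ ⟨
    + log ℓ     ≡⟨ cong +_ (Log-injective ℓ ℓ′ y≡y′) ⟩
    + log ℓ′    ≈⟨ log≡m ℓ′ ⟩
    + _         ∎
    where open ≡-mod-Reasoning q

  S-value-injective : ∀ {m i j} → m < q → i < t → j < t → S-value m i ≡ S-value m j → i ≡ j
  S-value-injective {m} {i} {j} m<q i<t j<t sᵢ≡sⱼ = ℕ.*-cancelˡ-≡ i j q (ℕ.+-cancelˡ-≡ m _ _
    (θ^-injective p-prime gen (exponent<p-1 m<q i<t) (exponent<p-1 m<q j<t) (begin
      + (θ ^ (m + q * i))          ≡⟨ cong +_ (θ^m[θ^q]^n≡θ^[m+q*n] m i) ⟨
      + (θ ^ m * (θ ^ q) ^ i)      ≈⟨ mod'-≡-mod _ p ⟨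
      + S-value m i                ≡⟨ cong +_ sᵢ≡sⱼ ⟩
      + S-value m j                ≈⟨ mod'-≡-mod _ p ⟩
      + (θ ^ m * (θ ^ q) ^ j)      ≡⟨ cong +_ (θ^m[θ^q]^n≡θ^[m+q*n] m j) ⟩
      + (θ ^ (m + q * j))          ∎)))
    where open ≡-mod-Reasoning p

  S-fibre : ∀ {m} → m < q → (f : ℕ → ℕ) (c k k⁻¹ : ℤ) → (∀ b → f b < p) →
    (∀ b → + f b ≡ c ℤ.+ k ℤ.* + b mod p) → k ℤ.* k⁻¹ ≡ + 1 mod p →
    count (λ b → inS p q t θ m (f (toℕ b))) (allFin p) ≡ t
  S-fibre {m} m<q f c k k⁻¹ f<p f≡c+kb kk⁻¹≡1 = begin
      count (λ b → inS p q t θ m (f (toℕ b))) (allFin p)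
    ≡⟨ count-cong (allFin p) inS≡any-ψ≡ ⟩
      count (λ b → any (λ n → ψ (S-value m n) ≡ᵇ toℕ b) (upTo t)) (allFin p)
    ≡⟨ count-allFin-any (λ n → ψ (S-value m n)) (upTo t)
                        (All.applyUpTo⁺₂ _ t (λ n → ψ<p (S-value m n))) (AllPairs.applyUpTo⁺₁ _ t distinct) ⟩
      length (upTo t)
    ≡⟨ List.length-upTo t ⟩
      t ∎
    where
    open ≡-Reasoning
    open AffineBijection f c k k⁻¹ f<p f≡c+kb kk⁻¹≡1

    inS≡any-ψ≡ : ∀ b → inS p q t θ m (f (toℕ b)) ≡ any (λ n → ψ (S-value m n) ≡ᵇ toℕ b) (upTo t)
    inS≡any-ψ≡ b = cong or (List.map-cong (λ n → ≡ᵇ-cong-⇔ (≡f⇔ψ≡ (mod'-< _ p) (toℕ<n b))) (upTo t))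

    distinct : ∀ {i j} → i < j → j < t → ψ (S-value m i) ≢ ψ (S-value m j)
    distinct i<j j<t ψsᵢ≡ψsⱼ = ℕ.<⇒≢ i<j (S-value-injective m<q (ℕ.<-trans i<j j<t) j<t
      (ψ-injective (mod'-< _ p) (mod'-< _ p) ψsᵢ≡ψsⱼ))

  sum∈S : Γ p q → Γ p q → Bool
  sum∈S (x , y) (a , b) = inS p q t θ ((toℕ x + toℕ a) mod' q) ((toℕ y + toℕ b) mod' p)

  Γ-list-unique : Unique (Γ-list p q)
  Γ-list-unique = cartesianProduct⁺ (allFin⁺ q) (allFin⁺ p)

  ∈-Γ-list : ∀ v → v ∈ Γ-list p q
  ∈-Γ-list (x , y) = ∈-cartesianProduct⁺ (∈-allFin x) (∈-allFin y)

  eqΓ⇔≡ : ∀ v w → T (eqΓ {p} {q} v w) ⇔ w ≡ v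
  eqΓ⇔≡ (x , y) (a , b) = mk⇔
    (λ x≡a∧y≡b → let x≡a , y≡b = Equivalence.to Bool.T-∧ x≡a∧y≡b in
      cong₂ _,_ (toℕ-injective (sym (ℕ.≡ᵇ⇒≡ _ _ x≡a))) (toℕ-injective (sym (ℕ.≡ᵇ⇒≡ _ _ y≡b))))
    (λ { refl → Equivalence.from Bool.T-∧ (ℕ.≡⇒≡ᵇ (toℕ x) _ refl , ℕ.≡⇒≡ᵇ (toℕ y) _ refl) })

  count-Γ : (F : Γ p q → Bool) → (∀ a → count (λ b → F (a , b)) (allFin p) ≡ t) →
    count F (Γ-list p q) ≡ p ∸ 1
  count-Γ F rows = trans (count-cartesianProduct F (allFin q) (allFin p) rows)
                         (trans (cong (_* t) (List.length-tabulate {n = q} id)) q*t≡p-1)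

  count-sum∈S : ∀ v → count (sum∈S v) (Γ-list p q) ≡ p ∸ 1
  count-sum∈S (x , y) = count-Γ (sum∈S (x , y)) (λ a →
    S-fibre (mod'-< _ q) (λ b → (toℕ y + b) mod' p) (+ toℕ y) (+ 1) (+ 1)
            (λ b → mod'-< _ p) translation (≡⇒≡-mod refl))
    where
    translation : ∀ b → + ((toℕ y + b) mod' p) ≡ + toℕ y ℤ.+ + 1 ℤ.* + b mod p
    translation b =
      ≡-mod-trans (mod'-≡-mod _ p) (≡⇒≡-mod (cong (λ x → + toℕ y ℤ.+ x) (sym (ℤ.*-identityˡ (+ b)))))

  loop+degH≡p-1 : ∀ v → indicator (sum∈S v v) + degH p q t θ v ≡ p ∸ 1
  loop+degH≡p-1 v = begin
    indicator (sum∈S v v) + degH p q t θ v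
      ≡⟨ cong (_+ degH p q t θ v) (count-∧-singleton (eqΓ v) (sum∈S v) Γ-list-unique (∈-Γ-list v) (eqΓ⇔≡ v)) ⟨
    count (λ w → eqΓ v w ∧ sum∈S v w) (Γ-list p q) + count (λ w → not (eqΓ v w) ∧ sum∈S v w) (Γ-list p q)
      ≡⟨ count-partition (eqΓ v) (sum∈S v) (Γ-list p q) ⟨
    count (sum∈S v) (Γ-list p q)
      ≡⟨ count-sum∈S v ⟩
    p ∸ 1 ∎
    where open ≡-Reasoning

  p-1≡1+[p-2] : p ∸ 1 ≡ suc (p ∸ 2)
  p-1≡1+[p-2] = ℕ.+-∸-assoc 1 {p} {2} (nonTrivial⇒n>1 p {{prime⇒nonTrivial p-prime}})

  degH≡ᵇp-2 : ∀ v → (degH p q t θ v ≡ᵇ p ∸ 2) ≡ sum∈S v v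
  degH≡ᵇp-2 v = +indicator≡suc⇒≡ᵇ (degH p q t θ v) (p ∸ 2) (sum∈S v v)
    (trans (ℕ.+-comm (degH p q t θ v) _) (trans (loop+degH≡p-1 v) p-1≡1+[p-2]))

  deg*-just : ∀ v → deg* p q t θ (just v) ≡ p ∸ 1
  deg*-just v = begin
    deg* p q t θ (just v)
      ≡⟨ count-∷ (adj* p q t θ (just v)) nothing (map just (Γ-list p q)) ⟩
    indicator (degH p q t θ v ≡ᵇ p ∸ 2) + count (adj* p q t θ (just v)) (map just (Γ-list p q))
      ≡⟨ cong₂ _+_ (cong indicator (degH≡ᵇp-2 v)) (count-map (adj* p q t θ (just v)) just (Γ-list p q)) ⟩
    indicator (sum∈S v v) + degH p q t θ v
      ≡⟨ loop+degH≡p-1 v ⟩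
    p ∸ 1 ∎
    where open ≡-Reasoning

  deg*-nothing : p ≢ 2 → deg* p q t θ nothing ≡ p ∸ 1
  deg*-nothing p≢2 = begin
    deg* p q t θ nothing
      ≡⟨ count-map (adj* p q t θ nothing) just (Γ-list p q) ⟩
    count (λ w → degH p q t θ w ≡ᵇ p ∸ 2) (Γ-list p q)
      ≡⟨ count-cong (Γ-list p q) degH≡ᵇp-2 ⟩
    count (λ w → sum∈S w w) (Γ-list p q)
      ≡⟨ count-Γ (λ w → sum∈S w w) (λ a →
           S-fibre (mod'-< _ q) (λ b → (b + b) mod' p) 0ℤ (+ 2) (+ suc (p / 2))
                   (λ b → mod'-< _ p) doubling (2*[1+p/2]≡1-mod p-prime p≢2)) ⟩
    p ∸ 1 ∎
    where
    open ≡-Reasoning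

    doubling : ∀ b → + ((b + b) mod' p) ≡ 0ℤ ℤ.+ + 2 ℤ.* + b mod p
    doubling b = ≡-mod-trans (mod'-≡-mod _ p) (≡⇒≡-mod (identity (+ b)))
      where
      identity : ∀ x → x ℤ.+ x ≡ 0ℤ ℤ.+ + 2 ℤ.* x
      identity = solve-∀

  ≡-mod-p-1⇒≡-mod-q : ∀ {a b} → a ≡ b mod (p ∸ 1) → a ≡ b mod q
  ≡-mod-p-1⇒≡-mod-q {a} {b} = ≡-mod-weaken q t ∘ subst (a ≡ b mod_) (sym q*t≡p-1)

  quotient-by-q : ∀ {d} → d < p ∸ 1 → Fin t
  quotient-by-q {d} d<p-1 = fromℕ< (ℕ.m<n*o⇒m/o<n (subst (d <_) (trans (sym q*t≡p-1) (ℕ.*-comm q t)) d<p-1))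

  quotient-by-q-injective : ∀ {d d′} (d<p-1 : d < p ∸ 1) (d′<p-1 : d′ < p ∸ 1) →
    + d ≡ + d′ mod q → quotient-by-q d<p-1 ≡ quotient-by-q d′<p-1 → d ≡ d′
  quotient-by-q-injective d<p-1 d′<p-1 d≡d′ quotients≡ = %-/-injective q (≡-mod⇒%≡ q d≡d′)
    (trans (sym (toℕ-fromℕ< _)) (trans (cong toℕ quotients≡) (toℕ-fromℕ< _)))

  ≡-mod⇒Γ-≡ : ∀ {a a′ : Fin q} {b b′ : Fin p} →
    + toℕ a ≡ + toℕ a′ mod q → + toℕ b ≡ + toℕ b′ mod p → (a , b) ≡ (a′ , b′)
  ≡-mod⇒Γ-≡ a≡a′ b≡b′ = cong₂ _,_ (≡-mod⇒Fin-≡ a≡a′) (≡-mod⇒Fin-≡ b≡b′)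

  adjH⇒Log : ∀ ((x , y) (a , b) : Γ p q) → T (adjH p q t θ (x , y) (a , b)) →
    Log (toℕ x + toℕ a) (toℕ y + toℕ b)
  adjH⇒Log (x , y) (a , b) adjacent = inS⇒Log (toℕ x + toℕ a) (toℕ y + toℕ b)
    (proj₂ (Equivalence.to (Bool.T-∧ {not (eqΓ {p} {q} (x , y) (a , b))}) adjacent))

  adj*-nothing⇒Log : ∀ ((a , b) : Γ p q) → T (adj* p q t θ nothing (just (a , b))) →
    Log (toℕ a + toℕ a) (toℕ b + toℕ b)
  adj*-nothing⇒Log (a , b) adjacent =
    inS⇒Log (toℕ a + toℕ a) (toℕ b + toℕ b) (subst T (degH≡ᵇp-2 (a , b)) adjacent)

  θ^-+ : ∀ i j → + (θ ^ (i + j)) ≡ + (θ ^ i) ℤ.* + (θ ^ j)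
  θ^-+ i j = trans (cong +_ (ℕ.^-distribˡ-+-* θ i j)) (ℤ.pos-* (θ ^ i) (θ ^ j))

  log-difference : ∀ {m y m′ y′} → Log m y → Log m′ y′ → ℕ
  log-difference ℓ ℓ′ = (+ log ℓ′ ℤ.- + log ℓ) %ℕ (p ∸ 1)

  log-difference<p-1 : ∀ {m y m′ y′} (ℓ : Log m y) (ℓ′ : Log m′ y′) → log-difference ℓ ℓ′ < p ∸ 1
  log-difference<p-1 ℓ ℓ′ = ℤ.n%ℕd<d (+ log ℓ′ ℤ.- + log ℓ) (p ∸ 1)

  log-difference≡ : ∀ x x′ a {y y′} (ℓ : Log (x + a) y) (ℓ′ : Log (x′ + a) y′) →
    + log-difference ℓ ℓ′ ≡ + x′ ℤ.- + x mod q
  log-difference≡ x x′ a ℓ ℓ′ = begin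
    + log-difference ℓ ℓ′                 ≈⟨ ≡-mod-p-1⇒≡-mod-q (%ℕ-≡-mod _ (p ∸ 1)) ⟩
    + log ℓ′ ℤ.- + log ℓ                  ≈⟨ +-cong-mod (log≡m ℓ′) (-‿cong-mod (log≡m ℓ)) ⟩
    (+ x′ ℤ.+ + a) ℤ.- (+ x ℤ.+ + a)      ≡⟨ identity (+ x) (+ x′) (+ a) ⟩
    + x′ ℤ.- + x                          ∎
    where
    open ≡-mod-Reasoning q
    identity : ∀ x x′ a → (x′ ℤ.+ a) ℤ.- (x ℤ.+ a) ≡ x′ ℤ.- x
    identity = solve-∀

  log-difference-cross : ∀ {m₁ m₁′ m₂ m₂′ y₁ y₁′ y₂ y₂′}
    (ℓ₁ : Log m₁ y₁) (ℓ₁′ : Log m₁′ y₁′) (ℓ₂ : Log m₂ y₂) (ℓ₂′ : Log m₂′ y₂′) →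
    log-difference ℓ₁ ℓ₁′ ≡ log-difference ℓ₂ ℓ₂′ →
    + (log ℓ₁′ + log ℓ₂) ≡ + (log ℓ₂′ + log ℓ₁) mod (p ∸ 1)
  log-difference-cross ℓ₁ ℓ₁′ ℓ₂ ℓ₂′ differences≡ = begin
    l₁′ ℤ.+ l₂                    ≡⟨ identity l₁′ l₁ l₂ ⟩
    (l₁′ ℤ.- l₁) ℤ.+ (l₁ ℤ.+ l₂)  ≈⟨ +-congʳ-mod (l₁ ℤ.+ l₂) differences≡-mod ⟩
    (l₂′ ℤ.- l₂) ℤ.+ (l₁ ℤ.+ l₂)  ≡⟨ identity′ l₂′ l₁ l₂ ⟩
    l₂′ ℤ.+ l₁                    ∎
    where
    open ≡-mod-Reasoning (p ∸ 1)
    l₁ l₁′ l₂ l₂′ : ℤ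
    l₁ = + log ℓ₁
    l₁′ = + log ℓ₁′
    l₂ = + log ℓ₂
    l₂′ = + log ℓ₂′
    differences≡-mod : l₁′ ℤ.- l₁ ≡ l₂′ ℤ.- l₂ mod (p ∸ 1)
    differences≡-mod = %ℕ≡⇒≡-mod (l₁′ ℤ.- l₁) (l₂′ ℤ.- l₂) (p ∸ 1) differences≡
    identity : ∀ l₁′ l₁ l₂ → l₁′ ℤ.+ l₂ ≡ (l₁′ ℤ.- l₁) ℤ.+ (l₁ ℤ.+ l₂)
    identity = solve-∀
    identity′ : ∀ l₂′ l₁ l₂ → (l₂′ ℤ.- l₂) ℤ.+ (l₁ ℤ.+ l₂) ≡ l₂′ ℤ.+ l₁
    identity′ = solve-∀

  log-difference-collision : ∀ {m₁ m₁′ m₂ m₂′ y y′ b b′}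
    (ℓ₁ : Log m₁ (y + b)) (ℓ₁′ : Log m₁′ (y′ + b)) →
    (ℓ₂ : Log m₂ (y + b′)) (ℓ₂′ : Log m₂′ (y′ + b′)) →
    log-difference ℓ₁ ℓ₁′ ≡ log-difference ℓ₂ ℓ₂′ → + y ≡ + y′ mod p ⊎ + b ≡ + b′ mod p
  log-difference-collision {y = y} {y′} {b} {b′} ℓ₁ ℓ₁′ ℓ₂ ℓ₂′ differences≡ =
    map-⊎ (≡-mod-sym ∘ a-b≡0⇒a≡b-mod) (≡-mod-sym ∘ a-b≡0⇒a≡b-mod)
          (prime-mod-product p-prime [y′-y][b′-b]≡0)
    where
    cross-products≡ : (+ y′ ℤ.+ + b) ℤ.* (+ y ℤ.+ + b′) ≡ (+ y′ ℤ.+ + b′) ℤ.* (+ y ℤ.+ + b) mod p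
    cross-products≡ = begin
      (+ y′ ℤ.+ + b) ℤ.* (+ y ℤ.+ + b′)    ≈⟨ *-cong-mod (θ^log≡y ℓ₁′) (θ^log≡y ℓ₂) ⟨
      + (θ ^ log ℓ₁′) ℤ.* + (θ ^ log ℓ₂)    ≡⟨ θ^-+ (log ℓ₁′) (log ℓ₂) ⟨
      + (θ ^ (log ℓ₁′ + log ℓ₂))            ≈⟨ θ^-cong p-prime gen cross-sums≡ ⟩
      + (θ ^ (log ℓ₂′ + log ℓ₁))            ≡⟨ θ^-+ (log ℓ₂′) (log ℓ₁) ⟩
      + (θ ^ log ℓ₂′) ℤ.* + (θ ^ log ℓ₁)    ≈⟨ *-cong-mod (θ^log≡y ℓ₂′) (θ^log≡y ℓ₁) ⟩
      (+ y′ ℤ.+ + b′) ℤ.* (+ y ℤ.+ + b)    ∎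
      where
      open ≡-mod-Reasoning p
      cross-sums≡ : + (log ℓ₁′ + log ℓ₂) ≡ + (log ℓ₂′ + log ℓ₁) mod (p ∸ 1)
      cross-sums≡ = log-difference-cross ℓ₁ ℓ₁′ ℓ₂ ℓ₂′ differences≡

    [y′-y][b′-b]≡0 : (+ y′ ℤ.- + y) ℤ.* (+ b′ ℤ.- + b) ≡ 0ℤ mod p
    [y′-y][b′-b]≡0 =
      subst (_≡ 0ℤ mod p) (identity (+ y) (+ y′) (+ b) (+ b′)) (a≡b⇒a-b≡0-mod cross-products≡)
      where
      identity : ∀ y y′ b b′ →
        (y′ ℤ.+ b) ℤ.* (y ℤ.+ b′) ℤ.- (y′ ℤ.+ b′) ℤ.* (y ℤ.+ b) ≡ (y′ ℤ.- y) ℤ.* (b′ ℤ.- b)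
      identity = solve-∀

  two-vertices-code : ∀ {v v′} → v ≢ v′ → CommonNeighbourCode (adj* p q t θ) (just v) (just v′) (suc t)
  two-vertices-code {v@(x , y)} {v′@(x′ , y′)} v≢v′ =
    record { code = code ; code-injective = code-injective }
    where
    code : CommonNeighbour (adj* p q t θ) (just v) (just v′) → Fin (suc t)
    code (nothing , _)     = zero
    code (just w , h , h′) = suc (quotient-by-q (log-difference<p-1 (adjH⇒Log v w h) (adjH⇒Log v′ w h′)))

    code-injective : ∀ c c′ → code c ≡ code c′ → proj₁ c ≡ proj₁ c′
    code-injective (nothing , _) (nothing , _) _ = refl
    code-injective (just w₁@(a , b) , h₁ , h₁′) (just w₂@(a′ , b′) , h₂ , h₂′) codes≡ =
      [ ⊥-elim ∘ v≢v′ ∘ v≡v′ , cong just ∘ w₁≡w₂ ]′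
        (log-difference-collision ℓ₁ ℓ₁′ ℓ₂ ℓ₂′ differences≡)
      where
      ℓ₁ : Log (toℕ x + toℕ a) (toℕ y + toℕ b)
      ℓ₁ = adjH⇒Log v w₁ h₁
      ℓ₁′ : Log (toℕ x′ + toℕ a) (toℕ y′ + toℕ b)
      ℓ₁′ = adjH⇒Log v′ w₁ h₁′
      ℓ₂ : Log (toℕ x + toℕ a′) (toℕ y + toℕ b′)
      ℓ₂ = adjH⇒Log v w₂ h₂
      ℓ₂′ : Log (toℕ x′ + toℕ a′) (toℕ y′ + toℕ b′)
      ℓ₂′ = adjH⇒Log v′ w₂ h₂′

      differences≡ : log-difference ℓ₁ ℓ₁′ ≡ log-difference ℓ₂ ℓ₂′
      differences≡ = quotient-by-q-injective (log-difference<p-1 ℓ₁ ℓ₁′) (log-difference<p-1 ℓ₂ ℓ₂′)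
        (≡-mod-trans (log-difference≡ (toℕ x) (toℕ x′) (toℕ a) ℓ₁ ℓ₁′)
                     (≡-mod-sym (log-difference≡ (toℕ x) (toℕ x′) (toℕ a′) ℓ₂ ℓ₂′)))
        (suc-injective codes≡)

      v≡v′ : + toℕ y ≡ + toℕ y′ mod p → v ≡ v′
      v≡v′ y≡y′ =
        ≡-mod⇒Γ-≡ (+-cancelʳ-mod (+ toℕ a) (Log-determines-m ℓ₁ ℓ₁′ (+-congʳ-mod (+ toℕ b) y≡y′))) y≡y′

      w₁≡w₂ : + toℕ b ≡ + toℕ b′ mod p → w₁ ≡ w₂
      w₁≡w₂ b≡b′ =
        ≡-mod⇒Γ-≡ (+-cancelˡ-mod (+ toℕ x) (Log-determines-m ℓ₁ ℓ₂ (+-congˡ-mod (+ toℕ y) b≡b′))) b≡b′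

  log-excess : ∀ {m y m′ y′} → Log m y → Log m′ y′ → ℕ
  log-excess ℓ ℓ₂ = (+ log ℓ ℤ.+ + log ℓ ℤ.- + log ℓ₂) %ℕ (p ∸ 1)

  log-excess<p-1 : ∀ {m y m′ y′} (ℓ : Log m y) (ℓ₂ : Log m′ y′) → log-excess ℓ ℓ₂ < p ∸ 1
  log-excess<p-1 ℓ ℓ₂ = ℤ.n%ℕd<d (+ log ℓ ℤ.+ + log ℓ ℤ.- + log ℓ₂) (p ∸ 1)

  log-excess≡ : ∀ x a {y y′} (ℓ : Log (x + a) y) (ℓ₂ : Log (a + a) y′) →
    + log-excess ℓ ℓ₂ ≡ + x ℤ.+ + x mod q
  log-excess≡ x a ℓ ℓ₂ = begin
    + log-excess ℓ ℓ₂                                  ≈⟨ ≡-mod-p-1⇒≡-mod-q (%ℕ-≡-mod _ (p ∸ 1)) ⟩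
    + log ℓ ℤ.+ + log ℓ ℤ.- + log ℓ₂                   ≈⟨ +-cong-mod (+-cong-mod m≡ m≡) (-‿cong-mod (log≡m ℓ₂)) ⟩
    (+ x ℤ.+ + a) ℤ.+ (+ x ℤ.+ + a) ℤ.- (+ a ℤ.+ + a)  ≡⟨ identity (+ x) (+ a) ⟩
    + x ℤ.+ + x                                        ∎
    where
    open ≡-mod-Reasoning q
    m≡ : + log ℓ ≡ + x ℤ.+ + a mod q
    m≡ = log≡m ℓ
    identity : ∀ x a → (x ℤ.+ a) ℤ.+ (x ℤ.+ a) ℤ.- (a ℤ.+ a) ≡ x ℤ.+ x
    identity = solve-∀

  θ^log-excess : ∀ {m m′ y b} (ℓ : Log m (y + b)) (ℓ₂ : Log m′ (b + b)) →
    IsRoot y (θ ^ log-excess ℓ ℓ₂) b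
  θ^log-excess {y = y} {b} ℓ ℓ₂ = begin
    + (θ ^ e) ℤ.* (+ b ℤ.+ + b)        ≈⟨ *-congˡ-mod (+ (θ ^ e)) (θ^log≡y ℓ₂) ⟨
    + (θ ^ e) ℤ.* + (θ ^ log ℓ₂)       ≡⟨ θ^-+ e (log ℓ₂) ⟨
    + (θ ^ (e + log ℓ₂))               ≈⟨ θ^-cong p-prime gen exponents≡ ⟩
    + (θ ^ (log ℓ + log ℓ))            ≡⟨ θ^-+ (log ℓ) (log ℓ) ⟩
    + (θ ^ log ℓ) ℤ.* + (θ ^ log ℓ)    ≈⟨ *-cong-mod (θ^log≡y ℓ) (θ^log≡y ℓ) ⟩
    (+ y ℤ.+ + b) ℤ.* (+ y ℤ.+ + b)    ∎
    where
    open ≡-mod-Reasoning p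
    e : ℕ
    e = log-excess ℓ ℓ₂
    exponents≡ : + (e + log ℓ₂) ≡ + (log ℓ + log ℓ) mod (p ∸ 1)
    exponents≡ = ≡-mod-trans
      (+-congʳ-mod (+ log ℓ₂) (%ℕ-≡-mod (+ log ℓ ℤ.+ + log ℓ ℤ.- + log ℓ₂) (p ∸ 1)))
      (≡⇒≡-mod (identity (+ log ℓ) (+ log ℓ₂)))
      where
      identity : ∀ l l₂ → l ℤ.+ l ℤ.- l₂ ℤ.+ l₂ ≡ l ℤ.+ l
      identity = solve-∀

  log-excess-collision : ∀ {x y a b a′ b′}
    (ℓ₁ : Log (x + a) (y + b)) (double₁ : Log (a + a) (b + b)) →
    (ℓ₂ : Log (x + a′) (y + b′)) (double₂ : Log (a′ + a′) (b′ + b′)) → b < p → b′ < p →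
    quotient-by-q (log-excess<p-1 ℓ₁ double₁) ≡ quotient-by-q (log-excess<p-1 ℓ₂ double₂) →
    (b <ᵇ other-root y (θ ^ log-excess ℓ₁ double₁) b) ≡ (b′ <ᵇ other-root y (θ ^ log-excess ℓ₂ double₂) b′) →
    b ≡ b′ × (+ a ≡ + a′ mod q)
  log-excess-collision {x} {y} {a} {b} {a′} {b′} ℓ₁ double₁ ℓ₂ double₂ b<p b′<p quotients≡ orders≡ =
    b≡b′ , +-cancelˡ-mod (+ x) (Log-determines-m ℓ₁ ℓ₂ (≡⇒≡-mod (cong (λ n → + (y + n)) b≡b′)))
    where
    excesses≡ : log-excess ℓ₁ double₁ ≡ log-excess ℓ₂ double₂
    excesses≡ = quotient-by-q-injective (log-excess<p-1 ℓ₁ double₁) (log-excess<p-1 ℓ₂ double₂)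
      (≡-mod-trans (log-excess≡ x a ℓ₁ double₁) (≡-mod-sym (log-excess≡ x a′ ℓ₂ double₂))) quotients≡

    T₂≡T₁ : θ ^ log-excess ℓ₂ double₂ ≡ θ ^ log-excess ℓ₁ double₁
    T₂≡T₁ = cong (θ ^_) (sym excesses≡)

    b≡b′ : b ≡ b′
    b≡b′ = root-determined-by-order {y} {θ ^ log-excess ℓ₁ double₁} b<p b′<p
      (θ^log-excess {y = y} {b} ℓ₁ double₁)
      (subst (λ T → IsRoot y T b′) T₂≡T₁ (θ^log-excess {y = y} {b′} ℓ₂ double₂))
      (trans orders≡ (cong (λ T → b′ <ᵇ other-root y T b′) T₂≡T₁))

  new-vertex-code : ∀ {v} → CommonNeighbourCode (adj* p q t θ) nothing (just v) (2 * t)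
  new-vertex-code {v@(x , y)} = record { code = code ; code-injective = code-injective }
    where
    Bool↣Fin2 : Bool ↣ Fin 2
    Bool↣Fin2 = ↔⇒↣ (↔-sym 2↔Bool)

    excess : ∀ w → T (adj* p q t θ nothing (just w)) → T (adjH p q t θ v w) → ℕ
    excess w h h′ = log-excess (adjH⇒Log v w h′) (adj*-nothing⇒Log w h)

    order-bit : ∀ w → T (adj* p q t θ nothing (just w)) → T (adjH p q t θ v w) → Bool
    order-bit w@(_ , b) h h′ = toℕ b <ᵇ other-root (toℕ y) (θ ^ excess w h h′) (toℕ b)

    code-quotient : ∀ w → T (adj* p q t θ nothing (just w)) → T (adjH p q t θ v w) → Fin t
    code-quotient w h h′ = quotient-by-q (log-excess<p-1 (adjH⇒Log v w h′) (adj*-nothing⇒Log w h))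

    code : CommonNeighbour (adj* p q t θ) nothing (just v) → Fin (2 * t)
    code (just w , h , h′) = combine (Injection.to Bool↣Fin2 (order-bit w h h′)) (code-quotient w h h′)

    code-injective : ∀ c c′ → code c ≡ code c′ → proj₁ c ≡ proj₁ c′
    code-injective (just w₁@(a , b) , h₁ , h₁′) (just w₂@(a′ , b′) , h₂ , h₂′) codes≡ =
      cong just (≡-mod⇒Γ-≡ (proj₂ collision) (≡⇒≡-mod (cong +_ (proj₁ collision))))
      where
      parts≡ : Injection.to Bool↣Fin2 (order-bit w₁ h₁ h₁′) ≡ Injection.to Bool↣Fin2 (order-bit w₂ h₂ h₂′) ×
               code-quotient w₁ h₁ h₁′ ≡ code-quotient w₂ h₂ h₂′
      parts≡ = combine-injective _ _ _ _ codes≡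

      collision : toℕ b ≡ toℕ b′ × (+ toℕ a ≡ + toℕ a′ mod q)
      collision = log-excess-collision (adjH⇒Log v w₁ h₁′) (adj*-nothing⇒Log w₁ h₁)
        (adjH⇒Log v w₂ h₂′) (adj*-nothing⇒Log w₂ h₂) (toℕ<n b) (toℕ<n b′)
        (proj₂ parts≡) (Injection.injective Bool↣Fin2 (proj₁ parts≡))

Maybe-Fin×Fin↔Fin : ∀ m n → Maybe (Fin m × Fin n) ↔ Fin (suc (m * n))
Maybe-Fin×Fin↔Fin m n = mk↔ₛ′ to from to∘from from∘to
  where
  to : Maybe (Fin m × Fin n) → Fin (suc (m * n))
  to nothing        = zero
  to (just (i , j)) = suc (combine i j)
  from : Fin (suc (m * n)) → Maybe (Fin m × Fin n)
  from zero    = nothing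
  from (suc k) = just (remQuot n k)
  to∘from : ∀ k → to (from k) ≡ k
  to∘from zero    = refl
  to∘from (suc k) = cong suc (combine-remQuot {m} n k)
  from∘to : ∀ v → from (to v) ≡ v
  from∘to nothing        = refl
  from∘to (just (i , j)) = cong just (remQuot-combine i j)

corollary4p4 : (p t q θ : ℕ) → Prime p → p ≢ 2 → 1 ≤ t → q * t ≡ p ∸ 1 →
    IsGenerator p θ →
    (∀ v → deg* p q t θ v ≡ p ∸ 1) ×
    (V* p q ↔ Fin (p * q + 1)) ×
    ¬ ContainsK2 (V* p q) (adj* p q t θ) (2 * t + 1)
corollary4p4 p t q θ p-prime p≢2 1≤t q*t≡p-1 gen =
  regular ,
  subst (λ n → V* p q ↔ Fin n) (trans (cong suc (ℕ.*-comm q p)) (ℕ.+-comm 1 (p * q))) (Maybe-Fin×Fin↔Fin q p) ,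
  codes⇒¬ContainsK2 (adj* p q t θ) (2 * t + 1) codes
  where
  open SumGraph {p} {q} {t} {θ} p-prime q*t≡p-1 gen

  regular : ∀ v → deg* p q t θ v ≡ p ∸ 1
  regular nothing  = deg*-nothing p≢2
  regular (just v) = deg*-just v

  codes : ∀ {u₁ u₂} → u₁ ≢ u₂ →
    Σ ℕ λ k → k < 2 * t + 1 × CommonNeighbourCode (adj* p q t θ) u₁ u₂ k
  codes {nothing} {nothing} u₁≢u₂ = ⊥-elim (u₁≢u₂ refl)
  codes {just v}  {just v′} v≢v′  = suc t , 1+t<2t+1 1≤t , two-vertices-code (v≢v′ ∘ cong just)
  codes {nothing} {just v}  _     = 2 * t , ℕ.m<m+n (2 * t) z<s , new-vertex-code
  codes {just v}  {nothing} _     = 2 * t , ℕ.m<m+n (2 * t) z<s , CommonNeighbourCode-swap new-vertex-code
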